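{- Let $G$ be a tree and let $u$ be a leaf of $G$ whose neighbour $v$ has degree at least $3$. If $H$ is the tree obtained from $G$ by deleting $u$, then $m(H)=m(G)$.
   Context: For a connected graph $G$: a cat sequence is any sequence $c_1,\ldots,c_t$ of vertices of $G$; a mouse sequence is a sequence $m_1,\ldots,m_t$ of vertices with $m_im_{i+1}\in E(G)$ for $1\le i\le t-1$, and it beats the cat sequence if $m_i\neq c_i$ for all $i$. The mouse can survive to time $t$ on $G$ if every cat sequence of length $t$ is beaten by some mouse sequence. $m(G)$ is the least positive integer $t$ such that the mouse cannot survive to time $t$ on $G$, and $m(G)=\infty$ if no such $t$ exists. -}

module Defs where

open import Data.Nat using (ℕ; zero; suc; _≤_; _<_)
open import Data.Fin using (Fin; toℕ; punchIn)
open import Data.Bool using (Bool; true; false)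
open import Data.List using (List; length; filterᵇ; allFin)
open import Data.Maybe using (Maybe; just; nothing)
open import Data.Product using (Σ; ∃; _×_)
open import Data.Sum using (_⊎_)
open import Relation.Binary.PropositionalEquality using (_≡_; _≢_)
open import Relation.Nullary using (¬_)
open import Function.Definitions using (Injective)

record Graph (n : ℕ) : Set where
  field
    adj     : Fin n → Fin n → Bool
    adj-sym : ∀ x y → adj x y ≡ adj y x
    irrefl  : ∀ x → adj x x ≡ false
open Graph public

Adjacent : ∀ {n} → Graph n → Fin n → Fin n → Set
Adjacent G x y = adj G x y ≡ true

degree : ∀ {n} → Graph n → Fin n → ℕ
degree {n} G v = length (filterᵇ (adj G v) (allFin n))

data Walk {n} (G : Graph n) : Fin n → Fin n → Set where
  [] : ∀ {x} → Walk G x x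
  _∷_ : ∀ {x y z} → Adjacent G x y → Walk G y z → Walk G x z

Connected : ∀ {n} → Graph n → Set
Connected G = ∀ x y → Walk G x y

HasCycle : ∀ {n} → Graph n → Set
HasCycle {n} G =
  Σ ℕ λ k → 3 ≤ k × Σ (Fin k → Fin n) λ c → Injective _≡_ _≡_ c ×
    (∀ (i j : Fin k) → (suc (toℕ i) ≡ toℕ j ⊎ (suc (toℕ i) ≡ k × toℕ j ≡ 0))
        → Adjacent G (c i) (c j))

IsTree : ∀ {n} → Graph n → Set
IsTree G = Connected G × ¬ HasCycle G

deleteVertex : ∀ {n} → Graph (suc n) → Fin (suc n) → Graph n
deleteVertex G u = record
  { adj     = λ i j → adj G (punchIn u i) (punchIn u j)
  ; adj-sym = λ i j → adj-sym G (punchIn u i) (punchIn u j)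
  ; irrefl  = λ i → irrefl G (punchIn u i) }

MouseSeq : ∀ {n} → Graph n → (t : ℕ) → (Fin t → Fin n) → Set
MouseSeq G t m = ∀ (i j : Fin t) → suc (toℕ i) ≡ toℕ j → Adjacent G (m i) (m j)

Beats : ∀ {n} {t : ℕ} → (m c : Fin t → Fin n) → Set
Beats m c = ∀ i → m i ≢ c i

Survives : ∀ {n} → Graph n → ℕ → Set
Survives {n} G t = ∀ (c : Fin t → Fin n) → ∃ λ (m : Fin t → Fin n) → MouseSeq G t m × Beats m c

-- IsMouseNumber G k  means  m(G) = k, where k = just t stands for the
-- positive integer t and k = nothing stands for ∞.
IsMouseNumber : ∀ {n} → Graph n → Maybe ℕ → Set
IsMouseNumber G (just t) = 1 ≤ t × ¬ Survives G t × (∀ s → 1 ≤ s → s < t → Survives G s)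
IsMouseNumber G nothing  = ∀ t → Survives G t

module Submission where

-- Only two facts about G are used: u has v as its unique
-- neighbour, and v has two distinct neighbours w₁, w₂ other than u.
--
-- The argument is a pair of simulations.  A graph B simulates a graph A if
-- every cat position of B can be translated to one of A and every mouse
-- position of A (given the current cat position of B) back to B, preserving
-- edges and cat-avoidance; then a surviving mouse on A yields a surviving
-- mouse on B (`simulate`), and graphs that survive to the same times have
-- the same mouse number (`transport-mouse-number`).
--  * G simulates G - u (`deletion-embeds`): the mouse keeps its strategy,
--    embedded by punchIn; a cat sitting on u is sent to an arbitrary vertex.
--  * G - u simulates G (`leaf-deletion-simulates`): whenever the mouse of G
--    would enter u, it instead goes to whichever of w₁, w₂ the cat does not
--    occupy; as u is only ever entered from or left to v, steps stay edges.

open import Defs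
open import Data.Nat using (ℕ; suc; _≤_; s≤s)
open import Data.Fin using (Fin; punchIn; punchOut)
open import Data.Fin.Properties using (punchIn-punchOut; punchInᵢ≢i; punchIn-injective; _≟_)
open import Data.Maybe using (Maybe; just; nothing)
open import Data.Product using (_×_; _,_; proj₂; ∃)
open import Data.List using (List; []; _∷_; length; filterᵇ; allFin)
open import Data.List.Membership.Propositional using (_∈_)
open import Data.List.Membership.Propositional.Properties using (∈-filter⁺; ∈-filter⁻; ∈-allFin)
open import Data.List.Relation.Unary.Any using (here; there)
open import Data.List.Relation.Unary.All using (_∷_)
open import Data.List.Relation.Unary.AllPairs using (_∷_)
open import Data.List.Relation.Unary.Unique.Propositional using (Unique)
import Data.List.Relation.Unary.Unique.Propositional.Properties as Unique
open import Data.Empty using (⊥-elim)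
open import Function.Bundles using (_⇔_; mk⇔; Equivalence)
open import Relation.Nullary using (¬_; yes; no)
open import Relation.Nullary.Decidable using (T?)
open import Relation.Binary.PropositionalEquality
  using (_≡_; _≢_; refl; sym; trans; cong; subst; subst₂)
open import Data.Bool.Properties using (T-≡)


record Simulation {a b} (A : Graph a) (B : Graph b) : Set where
  field
    cat    : Fin b → Fin a
    mouse  : Fin b → Fin a → Fin b
    avoids : ∀ c x → x ≢ cat c → mouse c x ≢ c
    edges  : ∀ c d x y → Adjacent A x y → Adjacent B (mouse c x) (mouse d y)

simulate : ∀ {a b} {A : Graph a} {B : Graph b} → Simulation A B →
  ∀ t → Survives A t → Survives B t
simulate {A = A} {B} sim t survA c = reply (survA (λ i → cat (c i)))
  where
  open Simulation sim
  reply : (∃ λ m → MouseSeq A t m × Beats m (λ i → cat (c i))) →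
          (∃ λ m → MouseSeq B t m × Beats m c)
  reply (m , walk , beats) =
    (λ i → mouse (c i) (m i)) ,
    (λ i j step → edges (c i) (c j) (m i) (m j) (walk i j step)) ,
    (λ i → avoids (c i) (m i) (beats i))

transport-mouse-number : ∀ {a b} (A : Graph a) (B : Graph b) →
  (∀ t → Survives A t → Survives B t) → (∀ t → Survives B t → Survives A t) →
  ∀ k → IsMouseNumber A k → IsMouseNumber B k
transport-mouse-number A B A⇒B B⇒A (just t) (1≤t , dies , lives) =
  1≤t , (λ survB → dies (B⇒A t survB)) , λ s 1≤s s<t → A⇒B s (lives s 1≤s s<t)
transport-mouse-number A B A⇒B B⇒A nothing lives = λ t → A⇒B t (lives t)

neighbours : ∀ {n} → Graph n → Fin n → List (Fin n)
neighbours {n} G v = filterᵇ (adj G v) (allFin n)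

∈-neighbours⁺ : ∀ {n} (G : Graph n) {v x} → Adjacent G v x → x ∈ neighbours G v
∈-neighbours⁺ G {v} {x} vx =
  ∈-filter⁺ (λ y → T? (adj G v y)) (∈-allFin x) (Equivalence.from T-≡ vx)

∈-neighbours⁻ : ∀ {n} (G : Graph n) {v x} → x ∈ neighbours G v → Adjacent G v x
∈-neighbours⁻ {n} G {v} x∈ =
  Equivalence.to T-≡ (proj₂ (∈-filter⁻ (λ y → T? (adj G v y)) {xs = allFin n} x∈))

neighbours-unique : ∀ {n} (G : Graph n) v → Unique (neighbours G v)
neighbours-unique {n} G v = Unique.filter⁺ (λ y → T? (adj G v y)) (Unique.allFin⁺ n)

no-loop : ∀ {n} (G : Graph n) x → ¬ Adjacent G x x
no-loop G x x~x with trans (sym x~x) (irrefl G x)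
... | ()

singleton-∈ : ∀ {A : Set} {xs : List A} {x y} → length xs ≡ 1 → x ∈ xs → y ∈ xs → x ≡ y
singleton-∈ {xs = _ ∷ []} _ (here x≡z) (here y≡z) = trans x≡z (sym y≡z)

leaf-neighbour : ∀ {n} (G : Graph n) {u v x} →
  degree G u ≡ 1 → Adjacent G u v → Adjacent G u x → x ≡ v
leaf-neighbour G {u} deg uv ux =
  singleton-∈ {xs = neighbours G u} deg (∈-neighbours⁺ G ux) (∈-neighbours⁺ G uv)

record OtherNeighbours {n} (G : Graph n) (u v : Fin n) : Set where
  field
    w₁ w₂ : Fin n
    w₁≢w₂ : w₁ ≢ w₂
    w₁≢u  : w₁ ≢ u
    w₂≢u  : w₂ ≢ u
    v~w₁  : Adjacent G v w₁
    v~w₂  : Adjacent G v w₂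

choose-two : ∀ {n} (G : Graph n) {u v} a b c → a ≢ b → a ≢ c → b ≢ c →
  Adjacent G v a → Adjacent G v b → Adjacent G v c → OtherNeighbours G u v
choose-two G {u} a b c a≢b a≢c b≢c va vb vc with a ≟ u | b ≟ u
... | yes a≡u | _ = record
  { w₁ = b ; w₂ = c ; w₁≢w₂ = b≢c ; w₁≢u = λ b≡u → a≢b (trans a≡u (sym b≡u))
  ; w₂≢u = λ c≡u → a≢c (trans a≡u (sym c≡u)) ; v~w₁ = vb ; v~w₂ = vc }
... | no a≢u | yes b≡u = record
  { w₁ = a ; w₂ = c ; w₁≢w₂ = a≢c ; w₁≢u = a≢u
  ; w₂≢u = λ c≡u → b≢c (trans b≡u (sym c≡u)) ; v~w₁ = va ; v~w₂ = vc }
... | no a≢u | no b≢u = record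
  { w₁ = a ; w₂ = b ; w₁≢w₂ = a≢b ; w₁≢u = a≢u ; w₂≢u = b≢u ; v~w₁ = va ; v~w₂ = vb }

other-neighbours : ∀ {n} (G : Graph n) u v → 3 ≤ degree G v → OtherNeighbours G u v
other-neighbours G u v deg = first-three (neighbours G v) deg (neighbours-unique G v) (∈-neighbours⁻ G)
  where
  first-three : ∀ xs → 3 ≤ length xs → Unique xs → (∀ {x} → x ∈ xs → Adjacent G v x) →
    OtherNeighbours G u v
  first-three []              ()                _ _
  first-three (_ ∷ [])        (s≤s ())          _ _
  first-three (_ ∷ _ ∷ [])    (s≤s (s≤s ()))    _ _
  first-three (a ∷ b ∷ c ∷ _) _ ((a≢b ∷ a≢c ∷ _) ∷ (b≢c ∷ _) ∷ _) adjacent =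
    choose-two G a b c a≢b a≢c b≢c
      (adjacent (here refl)) (adjacent (there (here refl))) (adjacent (there (there (here refl))))

project : ∀ {n} (u : Fin (suc n)) → Fin n → Fin (suc n) → Fin n
project u d x with u ≟ x
... | yes _   = d
... | no u≢x = punchOut u≢x

punchIn-avoids : ∀ {n} (u : Fin (suc n)) d x y → y ≢ project u d x → punchIn u y ≢ x
punchIn-avoids u d x y y≢ u+y≡x with u ≟ x
... | yes u≡x = punchInᵢ≢i u y (trans u+y≡x (sym u≡x))
... | no u≢x = y≢ (punchIn-injective u y _ (trans u+y≡x (sym (punchIn-punchOut u≢x))))

deletion-embeds : ∀ {n} (G : Graph (suc n)) u → Fin n → Simulation (deleteVertex G u) G
deletion-embeds G u d = record
  { cat    = project u d
  ; mouse  = λ _ y → punchIn u y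
  ; avoids = λ c y → punchIn-avoids u d c y
  ; edges  = λ _ _ _ _ x~y → x~y }

module LeafDeletion {n} (G : Graph (suc n)) (u v : Fin (suc n))
  (only-v : ∀ {x} → Adjacent G u x → x ≡ v) (others : OtherNeighbours G u v) where
  open OtherNeighbours others

  dodge : Fin (suc n) → Fin (suc n)
  dodge c with w₁ ≟ c
  ... | yes _ = w₂
  ... | no _  = w₁

  dodge-avoids : ∀ c → dodge c ≢ c
  dodge-avoids c with w₁ ≟ c
  ... | yes w₁≡c = λ w₂≡c → w₁≢w₂ (trans w₁≡c (sym w₂≡c))
  ... | no w₁≢c = w₁≢c

  dodge≢u : ∀ c → dodge c ≢ u
  dodge≢u c with w₁ ≟ c
  ... | yes _ = w₂≢u
  ... | no _  = w₁≢u

  v~dodge : ∀ c → Adjacent G v (dodge c)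
  v~dodge c with w₁ ≟ c
  ... | yes _ = v~w₂
  ... | no _  = v~w₁

  reroute : Fin (suc n) → Fin (suc n) → Fin (suc n)
  reroute c x with u ≟ x
  ... | yes _ = dodge c
  ... | no _  = x

  reroute≢u : ∀ c x → reroute c x ≢ u
  reroute≢u c x with u ≟ x
  ... | yes _   = dodge≢u c
  ... | no u≢x = λ x≡u → u≢x (sym x≡u)

  reroute-avoids : ∀ c x → x ≢ c → reroute c x ≢ c
  reroute-avoids c x x≢c with u ≟ x
  ... | yes _ = dodge-avoids c
  ... | no _  = x≢c

  -- Every edge at u leads to v, and dodges are neighbours of v, so rerouting
  -- preserves edges.
  reroute-edges : ∀ c d x y → Adjacent G x y → Adjacent G (reroute c x) (reroute d y)
  reroute-edges c d x y x~y with u ≟ x | u ≟ y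
  ... | yes refl | yes refl = ⊥-elim (no-loop G u x~y)
  ... | yes refl | no _     =
    subst (Adjacent G (dodge c)) (sym (only-v x~y)) (trans (adj-sym G (dodge c) v) (v~dodge c))
  ... | no _     | yes refl =
    subst (λ z → Adjacent G z (dodge d)) (sym (only-v (trans (adj-sym G u x) x~y))) (v~dodge d)
  ... | no _ | no _ = x~y

  leaf-deletion-simulates : Simulation G (deleteVertex G u)
  leaf-deletion-simulates = record
    { cat    = punchIn u
    ; mouse  = mouse
    ; avoids = λ c x x≢c mouse≡c →
        reroute-avoids (punchIn u c) x x≢c (trans (sym (embed-mouse c x)) (cong (punchIn u) mouse≡c))
    ; edges  = λ c d x y x~y →
        subst₂ (Adjacent G) (sym (embed-mouse c x)) (sym (embed-mouse d y))
          (reroute-edges (punchIn u c) (punchIn u d) x y x~y) }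
    where
    mouse : Fin n → Fin (suc n) → Fin n
    mouse c x = punchOut (λ u≡ → reroute≢u (punchIn u c) x (sym u≡))

    embed-mouse : ∀ c x → punchIn u (mouse c x) ≡ reroute (punchIn u c) x
    embed-mouse c x = punchIn-punchOut _

lemma3 : ∀ {n} (G : Graph (suc n)) (u v : Fin (suc n)) →
    IsTree G → degree G u ≡ 1 → Adjacent G u v → 3 ≤ degree G v →
    ∀ (k : Maybe ℕ) → IsMouseNumber (deleteVertex G u) k ⇔ IsMouseNumber G k
lemma3 G u v _ deg-u u~v deg-v k =
  mk⇔ (transport-mouse-number H G H⇒G G⇒H k) (transport-mouse-number G H G⇒H H⇒G k)
  where
  H = deleteVertex G u

  u≢v : u ≢ v
  u≢v refl = no-loop G u u~v

  H⇒G : ∀ t → Survives H t → Survives G t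
  H⇒G = simulate (deletion-embeds G u (punchOut u≢v))

  G⇒H : ∀ t → Survives G t → Survives H t
  G⇒H = simulate (LeafDeletion.leaf-deletion-simulates G u v
          (leaf-neighbour G deg-u u~v) (other-neighbours G u v deg-v))
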